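{- Let $G$ be a chordal graph with clique tree $T$, and let $a,b,c$ be three pairwise non-adjacent vertices of $G$. Then $a$ is the middle of $b,c$ if and only if for all maximal cliques $Q_b,Q_c$ of $G$ with $b\in Q_b$ and $c\in Q_c$, the path $T[Q_b,Q_c]$ in $T$ between $Q_b$ and $Q_c$ has an edge $QQ'$ whose label $Q\cap Q'$ satisfies $Q\cap Q'\subseteq N(a)$.
   Context: Graphs are finite, without loops or parallel edges; $N(a)$ denotes the set of vertices adjacent to $a$. A graph is chordal if it has no induced cycle of length at least four. A clique tree of $G$ is a tree $T$ whose vertex set is the set of inclusion-maximal cliques of $G$ and such that for every vertex $v$ of $G$, the maximal cliques containing $v$ induce a subtree of $T$. The label of an edge $QQ'$ of $T$ is $Q\cap Q'$. For three pairwise non-adjacent vertices $a,b,c$, $a$ is said to be the middle of $b,c$ if every path in $G$ between $b$ and $c$ contains a vertex of $N(a)$. -}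

module Defs where

open import Data.Nat using (ℕ; zero; suc; _≤_)
open import Data.Fin using (Fin; toℕ)
open import Data.Fin.Subset using (Subset; _∈_; _⊆_; _∩_)
open import Data.Bool using (Bool; true; false)
open import Data.Vec using (tabulate)
open import Data.List using (List; []; _∷_)
open import Data.List.Relation.Unary.Any using (Any)
open import Data.List.Relation.Unary.All using (All)
open import Data.List.Relation.Unary.Unique.Propositional using (Unique)
open import Data.Product using (Σ; ∃; _×_; _,_)
open import Data.Sum using (_⊎_)
open import Relation.Binary.PropositionalEquality using (_≡_; _≢_)
open import Relation.Nullary using (¬_)
open import Function.Base using (_∘_)
open import Function.Definitions using (Injective)

record Graph : Set where
  field
    n       : ℕ
    adj     : Fin n → Fin n → Bool
    adj-sym : ∀ u v → adj u v ≡ adj v u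
    adj-irr : ∀ v → adj v v ≡ false

data Walk {k : ℕ} (R : Fin k → Fin k → Bool) : Fin k → Fin k → Set where
  stop : ∀ x → Walk R x x
  step : ∀ {x y z} → R x y ≡ true → Walk R y z → Walk R x z

verts : ∀ {k} {R : Fin k → Fin k → Bool} {x y} → Walk R x y → List (Fin k)
verts (stop x) = x ∷ []
verts (step {x = x} _ w) = x ∷ verts w

IsPath : ∀ {k} {R : Fin k → Fin k → Bool} {x y} → Walk R x y → Set
IsPath w = Unique (verts w)

data HasEdge {k : ℕ} {R : Fin k → Fin k → Bool} (P : Fin k → Fin k → Set)
     : ∀ {x z} → Walk R x z → Set where
  here  : ∀ {x y z} (e : R x y ≡ true) (w : Walk R y z) → P x y → HasEdge P (step e w)
  there : ∀ {x y z} (e : R x y ≡ true) {w : Walk R y z} → HasEdge P w → HasEdge P (step e w)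

module _ (G : Graph) where
  open Graph G

  Adj : Fin n → Fin n → Set
  Adj u v = adj u v ≡ true

  N : Fin n → Subset n
  N a = tabulate (adj a)

  IsClique : Subset n → Set
  IsClique Q = ∀ u v → u ∈ Q → v ∈ Q → u ≢ v → Adj u v

  IsMaximalClique : Subset n → Set
  IsMaximalClique Q = IsClique Q × (∀ Q' → IsClique Q' → Q ⊆ Q' → Q' ⊆ Q)

  CycAdj : ∀ {k} → Fin k → Fin k → Set
  CycAdj {k} i j = (suc (toℕ i) ≡ toℕ j) ⊎ (suc (toℕ j) ≡ toℕ i)
                 ⊎ ((suc (toℕ i) ≡ k × toℕ j ≡ 0) ⊎ (suc (toℕ j) ≡ k × toℕ i ≡ 0))

  InducedCycle : ℕ → Set
  InducedCycle k = Σ (Fin k → Fin n) λ f →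
    Injective _≡_ _≡_ f × (∀ i j → (Adj (f i) (f j) → CycAdj i j) × (CycAdj i j → Adj (f i) (f j)))

  Chordal : Set
  Chordal = ∀ k → 4 ≤ k → ¬ InducedCycle k

  Middle : Fin n → Fin n → Fin n → Set
  Middle a b c = ∀ (p : Walk adj b c) → IsPath p → Any (_∈ N a) (verts p)

  -- A clique tree: nodes Fin m, node i carries the maximal clique K i;
  -- i ↦ K i is a bijection onto the maximal cliques; T is a tree
  -- (between any two nodes there is exactly one path); and for every vertex v
  -- the nodes whose clique contains v induce a connected subgraph of T.
  record CliqueTree : Set where
    field
      m      : ℕ
      K      : Fin m → Subset n
      K-inj  : Injective _≡_ _≡_ K
      K-max  : ∀ i → IsMaximalClique (K i)
      K-surj : ∀ Q → IsMaximalClique Q → ∃ λ i → K i ≡ Q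
      tadj     : Fin m → Fin m → Bool
      tadj-sym : ∀ i j → tadj i j ≡ tadj j i
      tadj-irr : ∀ i → tadj i i ≡ false
      tree-path   : ∀ i j → Σ (Walk tadj i j) IsPath
      tree-unique : ∀ i j (p q : Walk tadj i j) → IsPath p → IsPath q → verts p ≡ verts q
      subtree : ∀ v i j → v ∈ K i → v ∈ K j →
                Σ (Walk tadj i j) λ p → All (λ l → v ∈ K l) (verts p)

    label : Fin m → Fin m → Subset n
    label i j = K i ∩ K j

-- Walks in G and walks in the clique tree can be traded for one another.
-- A tree walk from a clique of b to a clique of c none of whose edge labels
-- lies inside N(a) yields, label by label, vertices outside N(a) that
-- consecutively share a clique: a walk from b to c avoiding N(a).
-- Conversely, a walk b = v₀ v₁ … v_r = c avoiding N(a) is covered by the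
-- subtrees of its vertices, glued along cliques containing the edges vᵢvᵢ₊₁,
-- and every tree edge inside the subtree of vᵢ has vᵢ ∉ N(a) in its label.
module Submission where

open import Defs
open import Data.Fin using (Fin)
open import Data.Fin.Subset using (_∈_; _⊆_)
open import Relation.Binary.PropositionalEquality using (_≢_)
open import Relation.Nullary using (¬_)
open import Function.Bundles using (_⇔_)

open import Data.Nat using (ℕ)
open import Data.Bool using (Bool; true)
import Data.Bool.Properties as Bool
open import Data.Fin using (_≟_)
import Data.Fin.Properties as Fin
open import Data.Fin.Subset using (Subset; _∪_; ⁅_⁆; _∉_)
open import Data.Fin.Subset.Properties
  using (_∈?_; x∈⁅x⁆; x∈⁅y⁆⇒x≡y; p⊆p∪q; q⊆p∪q; x∈p∪q⁻; x∈p∩q⁺; x∈p∩q⁻)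
open import Data.Vec.Properties using (lookup∘tabulate; []=⇒lookup)
open import Data.List using (List; []; _∷_; allFin)
open import Data.List.Relation.Unary.Any using (here; there; any?)
open import Data.List.Relation.Unary.All using (All; []; _∷_)
open import Data.List.Relation.Unary.All.Properties.Core using (¬Any⇒All¬; All¬⇒¬Any)
open import Data.List.Relation.Unary.AllPairs using ([]; _∷_)
open import Data.List.Membership.Propositional using () renaming (_∈_ to _∈ₗ_)
open import Data.List.Membership.Propositional.Properties using (∈-allFin)
open import Data.List.Relation.Binary.Subset.Propositional using () renaming (_⊆_ to _⊆ₗ_)
open import Data.List.Relation.Binary.Subset.Propositional.Properties using (Any-resp-⊆)
open import Data.Product using (Σ; ∃; ∃₂; _×_; _,_; proj₁)
open import Data.Sum using (_⊎_; inj₁; inj₂; [_,_]′)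
import Data.Sum as Sum
open import Data.Empty using (⊥-elim)
open import Relation.Binary.PropositionalEquality using (_≡_; refl; sym; trans)
open import Relation.Nullary using (Dec; yes; no; _×-dec_)
open import Relation.Nullary.Decidable using (¬?; _→-dec_)
open import Function.Base using (id; _∘_)
open import Function.Bundles using (mk⇔)

⊆-or-witness : ∀ {n} (p q : Subset n) → p ⊆ q ⊎ ∃ λ u → u ∈ p × u ∉ q
⊆-or-witness p q with Fin.any? (λ u → (u ∈? p) ×-dec ¬? (u ∈? q))
... | yes witness = inj₂ witness
... | no ¬witness = inj₁ p⊆q
  where
    p⊆q : p ⊆ q
    p⊆q {u} u∈p with u ∈? q
    ... | yes u∈q = u∈q
    ... | no u∉q = ⊥-elim (¬witness (u , u∈p , u∉q))

module _ {k : ℕ} {R : Fin k → Fin k → Bool} where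

  _++ʷ_ : ∀ {x y z} → Walk R x y → Walk R y z → Walk R x z
  stop _   ++ʷ w = w
  step e v ++ʷ w = step e (v ++ʷ w)

  HasEdge-++⁻ : ∀ {P : Fin k → Fin k → Set} {x y z} (v : Walk R x y) (w : Walk R y z) →
                HasEdge P (v ++ʷ w) → HasEdge P v ⊎ HasEdge P w
  HasEdge-++⁻ (stop _)   w h                = inj₂ h
  HasEdge-++⁻ (step e v) w (here .e _ Pxy) = inj₁ (here e v Pxy)
  HasEdge-++⁻ (step e v) w (there .e h)    = Sum.map₁ (there e) (HasEdge-++⁻ v w h)

  All-verts-head : ∀ {Q : Fin k → Set} {x z} (w : Walk R x z) → All Q (verts w) → Q x
  All-verts-head (stop _)   (Qx ∷ _) = Qx
  All-verts-head (step _ _) (Qx ∷ _) = Qx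

  HasEdge-All : ∀ {P : Fin k → Fin k → Set} {Q : Fin k → Set} {x z} (w : Walk R x z) →
                All Q (verts w) → HasEdge P w → ∃₂ λ s t → Q s × Q t × P s t
  HasEdge-All (step e w) (Qx ∷ Qw) (here .e .w Pxy) = _ , _ , Qx , All-verts-head w Qw , Pxy
  HasEdge-All (step e w) (_ ∷ Qw)  (there .e h)     = HasEdge-All w Qw h

  record _≼_ {x y x′ y′} (v : Walk R x′ y′) (w : Walk R x y) : Set₁ where
    field
      verts-⊆ : verts v ⊆ₗ verts w
      edges-⊆ : ∀ {P : Fin k → Fin k → Set} → HasEdge P v → HasEdge P w
  open _≼_ public

  ≼-refl : ∀ {x y} {w : Walk R x y} → w ≼ w
  ≼-refl = record { verts-⊆ = id ; edges-⊆ = id }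

  ≼-trans : ∀ {x y x′ y′ x″ y″} {u : Walk R x y} {v : Walk R x′ y′} {w : Walk R x″ y″} →
            u ≼ v → v ≼ w → u ≼ w
  ≼-trans u≼v v≼w = record { verts-⊆ = verts-⊆ v≼w ∘ verts-⊆ u≼v
                           ; edges-⊆ = edges-⊆ v≼w ∘ edges-⊆ u≼v }

  ≼-stepʳ : ∀ {x y x′ y′ z} {v : Walk R x′ y′} {w : Walk R y z} (e : R x y ≡ true) →
            v ≼ w → v ≼ step e w
  ≼-stepʳ e v≼w = record { verts-⊆ = there ∘ verts-⊆ v≼w ; edges-⊆ = there e ∘ edges-⊆ v≼w }

  ≼-step : ∀ {x y z} {v w : Walk R y z} (e : R x y ≡ true) → v ≼ w → step e v ≼ step e w
  ≼-step {v = v} {w} e v≼w = record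
    { verts-⊆ = λ { (here eq) → here eq ; (there m) → there (verts-⊆ v≼w m) }
    ; edges-⊆ = λ { (here .e .v Pxy) → here e w Pxy ; (there .e h) → there e (edges-⊆ v≼w h) } }

  suffix : ∀ {x y z} (w : Walk R y z) → x ∈ₗ verts w →
           Σ (Walk R x z) λ v → v ≼ w × (IsPath w → IsPath v)
  suffix w@(stop _)   (here refl) = w , ≼-refl , id
  suffix w@(step _ _) (here refl) = w , ≼-refl , id
  suffix (step e w) (there m) with suffix w m
  ... | v , v≼w , path = v , ≼-stepʳ e v≼w , λ { (_ ∷ w-path) → path w-path }

  walk⇒path : ∀ {x z} (w : Walk R x z) → Σ (Walk R x z) λ p → IsPath p × p ≼ w
  walk⇒path (stop x) = stop x , [] ∷ [] , ≼-refl
  walk⇒path (step {x = x} e w) with walk⇒path w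
  ... | p , p-path , p≼w with any? (x ≟_) (verts p)
  ...   | no x∉p  = step e p , ¬Any⇒All¬ (verts p) x∉p ∷ p-path , ≼-step e p≼w
  ...   | yes x∈p with suffix p x∈p
  ...     | q , q≼p , q-path = q , q-path p-path , ≼-stepʳ e (≼-trans q≼p p≼w)

module _ (G : Graph) where
  open Graph G

  Adj-sym : ∀ {u v} → Adj G u v → Adj G v u
  Adj-sym {u} {v} e = trans (adj-sym v u) e

  ∈N⇒Adj : ∀ {a u} → u ∈ N G a → Adj G a u
  ∈N⇒Adj {a} {u} u∈Na = trans (sym (lookup∘tabulate (adj a) u)) ([]=⇒lookup u∈Na)

  AdjToAll : Subset n → Fin n → Set
  AdjToAll S w = ∀ u → u ∈ S → u ≢ w → Adj G u w

  adjToAll? : ∀ S w → Dec (AdjToAll S w)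
  adjToAll? S w = Fin.all? λ u → (u ∈? S) →-dec (¬? (u ≟ w) →-dec (adj u w Bool.≟ true))

  ⁅⁆-clique : ∀ v → IsClique G ⁅ v ⁆
  ⁅⁆-clique v x y x∈ y∈ x≢y = ⊥-elim (x≢y (trans (x∈⁅y⁆⇒x≡y v x∈) (sym (x∈⁅y⁆⇒x≡y v y∈))))

  ∪⁅⁆-clique : ∀ {S w} → IsClique G S → AdjToAll S w → IsClique G (S ∪ ⁅ w ⁆)
  ∪⁅⁆-clique {S} {w} S-clique S~w u v u∈ v∈ u≢v with x∈p∪q⁻ S ⁅ w ⁆ u∈ | x∈p∪q⁻ S ⁅ w ⁆ v∈
  ... | inj₁ u∈S | inj₁ v∈S = S-clique u v u∈S v∈S u≢v
  ... | inj₁ u∈S | inj₂ v∈w with x∈⁅y⁆⇒x≡y w v∈w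
  ...   | refl = S~w u u∈S u≢v
  ∪⁅⁆-clique {S} {w} S-clique S~w u v u∈ v∈ u≢v | inj₂ u∈w | inj₁ v∈S with x∈⁅y⁆⇒x≡y w u∈w
  ...   | refl = Adj-sym (S~w v v∈S (u≢v ∘ sym))
  ∪⁅⁆-clique {S} {w} S-clique S~w u v u∈ v∈ u≢v | inj₂ u∈w | inj₂ v∈w =
    ⁅⁆-clique w u v u∈w v∈w u≢v

  edge-clique : ∀ {u v} → Adj G u v → IsClique G (⁅ u ⁆ ∪ ⁅ v ⁆)
  edge-clique {u} e = ∪⁅⁆-clique (⁅⁆-clique u) λ x x∈u _ → case-u (x∈⁅y⁆⇒x≡y u x∈u)
    where
      case-u : ∀ {x} → x ≡ u → Adj G x _
      case-u refl = e

  extend : List (Fin n) → Subset n → Subset n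
  extend []       S = S
  extend (w ∷ ws) S with adjToAll? S w
  ... | yes _ = extend ws (S ∪ ⁅ w ⁆)
  ... | no _  = extend ws S

  extend-clique : ∀ ws {S} → IsClique G S → IsClique G (extend ws S)
  extend-clique []       S-clique = S-clique
  extend-clique (w ∷ ws) {S} S-clique with adjToAll? S w
  ... | yes S~w = extend-clique ws (∪⁅⁆-clique S-clique S~w)
  ... | no _    = extend-clique ws S-clique

  ⊆-extend : ∀ ws {S} → S ⊆ extend ws S
  ⊆-extend []       u∈S = u∈S
  ⊆-extend (w ∷ ws) {S} u∈S with adjToAll? S w
  ... | yes _ = ⊆-extend ws (p⊆p∪q ⁅ w ⁆ u∈S)
  ... | no _  = ⊆-extend ws u∈S

  extend-saturated : ∀ ws {S Q} → IsClique G Q → extend ws S ⊆ Q →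
                     ∀ {w} → w ∈ₗ ws → w ∈ Q → w ∈ extend ws S
  extend-saturated (w ∷ ws) {S} Q-clique ext⊆Q (here refl) w∈Q with adjToAll? S w
  ... | yes _   = ⊆-extend ws (q⊆p∪q S ⁅ w ⁆ (x∈⁅x⁆ w))
  ... | no S≁w = ⊥-elim (S≁w λ u u∈S → Q-clique u w (ext⊆Q (⊆-extend ws u∈S)) w∈Q)
  extend-saturated (w ∷ ws) {S} Q-clique ext⊆Q (there m) w∈Q with adjToAll? S w
  ... | yes _ = extend-saturated ws Q-clique ext⊆Q m w∈Q
  ... | no _  = extend-saturated ws Q-clique ext⊆Q m w∈Q

  ⊆-maximalClique : ∀ {S} → IsClique G S → ∃ λ Q → IsMaximalClique G Q × S ⊆ Q
  ⊆-maximalClique {S} S-clique =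
    extend (allFin n) S ,
    (extend-clique (allFin n) S-clique ,
     λ Q Q-clique ext⊆Q w∈Q → extend-saturated (allFin n) Q-clique ext⊆Q (∈-allFin _) w∈Q) ,
    ⊆-extend (allFin n)

  module _ (T : CliqueTree G) where
    open CliqueTree T

    ⊆-node : ∀ {S} → IsClique G S → ∃ λ i → S ⊆ K i
    ⊆-node S-clique with ⊆-maximalClique S-clique
    ... | Q , Q-max , S⊆Q with K-surj Q Q-max
    ...   | i , refl = i , S⊆Q

    vertex-node : ∀ v → ∃ λ i → v ∈ K i
    vertex-node v with ⊆-node (⁅⁆-clique v)
    ... | i , ⁅v⁆⊆Ki = i , ⁅v⁆⊆Ki (x∈⁅x⁆ v)

    edge-node : ∀ {u v} → Adj G u v → ∃ λ i → u ∈ K i × v ∈ K i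
    edge-node {u} {v} e with ⊆-node (edge-clique e)
    ... | i , uv⊆Ki = i , uv⊆Ki (p⊆p∪q ⁅ v ⁆ (x∈⁅x⁆ u)) , uv⊆Ki (q⊆p∪q ⁅ u ⁆ ⁅ v ⁆ (x∈⁅x⁆ v))

    module Separator (S : Subset n) where

      LabelIn : Fin m → Fin m → Set
      LabelIn i j = label i j ⊆ S

      Avoids : ∀ {u v} → Walk adj u v → Set
      Avoids w = All (_∉ S) (verts w)

      AvoidingWalk : Fin n → Fin n → Set
      AvoidingWalk u v = Σ (Walk adj u v) Avoids

      cons-in-node : ∀ {x u v c} → v ∈ K x → u ∈ K x → v ∉ S →
                     AvoidingWalk u c → AvoidingWalk v c
      cons-in-node {x} {u} {v} v∈Kx u∈Kx v∉S (w , w-avoids) with v ≟ u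
      ... | yes refl = w , w-avoids
      ... | no v≢u  = step (proj₁ (K-max x) v u v∈Kx u∈Kx v≢u) w , v∉S ∷ w-avoids

      labelIn-or-avoidingWalk : ∀ {v c x j} → v ∈ K x → v ∉ S → c ∈ K j → c ∉ S →
                                (p : Walk tadj x j) → HasEdge LabelIn p ⊎ AvoidingWalk v c
      labelIn-or-avoidingWalk v∈Kx v∉S c∈Kx c∉S (stop _) =
        inj₂ (cons-in-node v∈Kx c∈Kx v∉S (stop _ , c∉S ∷ []))
      labelIn-or-avoidingWalk {x = x} v∈Kx v∉S c∈Kj c∉S (step {y = y} e p)
        with ⊆-or-witness (label x y) S
      ... | inj₁ label⊆S = inj₁ (here e p label⊆S)
      ... | inj₂ (u , u∈label , u∉S) with x∈p∩q⁻ (K x) (K y) u∈label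
      ...   | u∈Kx , u∈Ky = Sum.map (there e) (cons-in-node v∈Kx u∈Kx v∉S)
                                    (labelIn-or-avoidingWalk u∈Ky u∉S c∈Kj c∉S p)

      avoidingWalk⇒treeWalk : ∀ {v c x} → v ∈ K x → (w : Walk adj v c) → Avoids w →
                              ∃ λ j → c ∈ K j × Σ (Walk tadj x j) (¬_ ∘ HasEdge LabelIn)
      avoidingWalk⇒treeWalk {x = x} v∈Kx (stop _) _ = x , v∈Kx , stop x , λ ()
      avoidingWalk⇒treeWalk {v} {x = x} v∈Kx (step e w) (v∉S ∷ w-avoids)
        with edge-node e
      ... | y , v∈Ky , v′∈Ky with subtree v x y v∈Kx v∈Ky
      ...   | W₁ , W₁-in-v with avoidingWalk⇒treeWalk v′∈Ky w w-avoids
      ...     | j , c∈Kj , W₂ , W₂-clear =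
        j , c∈Kj , W₁ ++ʷ W₂ , [ W₁-clear , W₂-clear ]′ ∘ HasEdge-++⁻ W₁ W₂
        where
          W₁-clear : ¬ HasEdge LabelIn W₁
          W₁-clear h with HasEdge-All W₁ W₁-in-v h
          ... | s , t , v∈Ks , v∈Kt , label⊆S = v∉S (label⊆S (x∈p∩q⁺ (v∈Ks , v∈Kt)))

lemma6 : (G : Graph) → Chordal G → (T : CliqueTree G) →
    (a b c : Fin (Graph.n G)) →
    a ≢ b → a ≢ c → b ≢ c →
    ¬ Adj G a b → ¬ Adj G a c → ¬ Adj G b c →
    Middle G a b c ⇔
    (∀ (i j : Fin (CliqueTree.m T)) → b ∈ CliqueTree.K T i → c ∈ CliqueTree.K T j →
    (p : Walk (CliqueTree.tadj T) i j) → IsPath p →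
    HasEdge (λ x y → CliqueTree.label T x y ⊆ N G a) p)
lemma6 G _ T a b c _ _ _ a≁b a≁c _ = mk⇔ labelIn-of-middle middle-of-labelIn
  where
    open Separator G T (N G a)

    labelIn-of-middle : Middle G a b c → ∀ i j → b ∈ CliqueTree.K T i → c ∈ CliqueTree.K T j →
                        (p : Walk (CliqueTree.tadj T) i j) → IsPath p → HasEdge LabelIn p
    labelIn-of-middle middle i j b∈Ki c∈Kj p _
      with labelIn-or-avoidingWalk b∈Ki (a≁b ∘ ∈N⇒Adj G) c∈Kj (a≁c ∘ ∈N⇒Adj G) p
    ... | inj₁ h = h
    ... | inj₂ (w , w-avoids) with walk⇒path w
    ...   | q , q-path , q≼w =
      ⊥-elim (All¬⇒¬Any w-avoids (Any-resp-⊆ (verts-⊆ q≼w) (middle q q-path)))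

    middle-of-labelIn : (∀ i j → b ∈ CliqueTree.K T i → c ∈ CliqueTree.K T j →
                         (p : Walk (CliqueTree.tadj T) i j) → IsPath p → HasEdge LabelIn p) →
                        Middle G a b c
    middle-of-labelIn labelIn p _ with any? (_∈? N G a) (verts p)
    ... | yes meets = meets
    ... | no misses with vertex-node G T b
    ...   | i , b∈Ki with avoidingWalk⇒treeWalk b∈Ki p (¬Any⇒All¬ (verts p) misses)
    ...     | j , c∈Kj , W , W-clear with walk⇒path W
    ...       | P , P-path , P≼W = ⊥-elim (W-clear (edges-⊆ P≼W (labelIn i j b∈Ki c∈Kj P P-path)))
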